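{- Let $G=(V_1,V_2,\ldots,V_p,E)$ be a finite $p$-partite graph viewed as a message-passing network, and let $k_1,\ldots,k_p$ be nonnegative integers. Suppose every node $v$ runs the distributed peeling protocol described below with threshold $k(v)=k_{p(v)}$, where $v\in V_{p(v)}$. Then, once all messages have been delivered and processed, the subgraph of $G$ induced by the nodes that are still active equals $G(k_1,k_2,\ldots,k_p)$, the largest subgraph of $G$ in which every vertex of $V_i$ has degree at least $k_i$ for every $i$.
   Context: A $p$-partite graph $G=(V_1,\ldots,V_p,E)$ is a graph whose vertex set is partitioned into disjoint sets $V_1,\ldots,V_p$ such that no edge joins two vertices of the same $V_i$. Distributed peeling protocol with thresholds $k(v)$: each node $v$ keeps a counter $degree$, initially $\deg_G(v)$, and a status, initially active. Initially (onInitial), if $degree<k(v)$, node $v$ sends an ``off'' message to each of its neighbors and becomes inactive; otherwise it waits. Whenever an active node $v$ receives an off message (onMessage), it decreases $degree$ by $1$, and if now $degree<k(v)$, it sends an off message to each of its neighbors and becomes inactive. An inactive node stays inactive and ignores all incoming messages. Every sent message is eventually delivered. -}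

module Defs where

open import Data.Bool using (Bool; true; false; if_then_else_; not)
open import Data.Nat using (ℕ; _∸_; _<ᵇ_; _≤_)
open import Data.Fin using (Fin; _≟_)
open import Data.Product using (_×_; _,_)
open import Data.List using (List; []; _∷_; _++_; map; filterᵇ; allFin; concatMap; length)
open import Relation.Nullary using (does; ¬_)
open import Relation.Binary.PropositionalEquality using (_≡_)
open import Relation.Binary.Construct.Closure.ReflexiveTransitive using (Star)

record Graph (n : ℕ) : Set where
  field
    adj     : Fin n → Fin n → Bool
    sym     : ∀ u v → adj u v ≡ adj v u
    irrefl  : ∀ v → adj v v ≡ false

open Graph public

IsPartite : ∀ {n p} → Graph n → (Fin n → Fin p) → Set
IsPartite G part = ∀ u v → adj G u v ≡ true → ¬ (part u ≡ part v)

neighbours : ∀ {n} → Graph n → Fin n → List (Fin n)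
neighbours {n} G v = filterᵇ (adj G v) (allFin n)

deg : ∀ {n} → Graph n → Fin n → ℕ
deg G v = length (neighbours G v)

record Subgraph {n : ℕ} (G : Graph n) : Set where
  field
    vert   : Fin n → Bool
    edge   : Fin n → Fin n → Bool
    edge-sym : ∀ u v → edge u v ≡ edge v u
    edge⊆G : ∀ u v → edge u v ≡ true → adj G u v ≡ true
    edge⊆V : ∀ u v → edge u v ≡ true → vert u ≡ true

open Subgraph public

degIn : ∀ {n} {G : Graph n} → Subgraph G → Fin n → ℕ
degIn {n} H v = length (filterᵇ (edge H v) (allFin n))

_and_ : Bool → Bool → Bool
true and b = b
false and b = false

induced : ∀ {n} (G : Graph n) → (Fin n → Bool) → Subgraph G
induced G S = record
  { vert = S
  ; edge = λ u v → S u and (S v and adj G u v)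
  ; edge-sym = λ u v → lemma (S u) (S v) (adj G u v) (adj G v u) (sym G u v)
  ; edge⊆G = λ u v e → l2 (S u) (S v) (adj G u v) e
  ; edge⊆V = λ u v e → l3 (S u) (S v) (adj G u v) e
  }
  where
  open import Relation.Binary.PropositionalEquality using (refl)
  lemma : ∀ a b c d → c ≡ d → (a and (b and c)) ≡ (b and (a and d))
  lemma true  true  c .c refl = refl
  lemma true  false c d _ = refl
  lemma false true  c d _ = refl
  lemma false false c d _ = refl
  l2 : ∀ a b c → (a and (b and c)) ≡ true → c ≡ true
  l2 true true c e = e
  l3 : ∀ a b c → (a and (b and c)) ≡ true → a ≡ true
  l3 true b c e = refl

_⊆G_ : ∀ {n} {G : Graph n} → Subgraph G → Subgraph G → Set
_⊆G_ {n} H H' = (∀ v → vert H v ≡ true → vert H' v ≡ true)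
              × (∀ u v → edge H u v ≡ true → edge H' u v ≡ true)

MinDeg : ∀ {n} {G : Graph n} → (Fin n → ℕ) → Subgraph G → Set
MinDeg k H = ∀ v → vert H v ≡ true → k v ≤ degIn H v

-- H is the largest subgraph of G satisfying the degree constraints k,
-- i.e. H is G(k_1,…,k_p) when k v = k_{p(v)}.
IsLargest : ∀ {n} {G : Graph n} → (Fin n → ℕ) → Subgraph G → Set
IsLargest {G = G} k H =
  MinDeg k H × (∀ (H' : Subgraph G) → MinDeg k H' → H' ⊆G H)

-- an "off" message: (sender , receiver)
Msg : ℕ → Set
Msg n = Fin n × Fin n

record State (n : ℕ) : Set where
  field
    active  : Fin n → Bool
    counter : Fin n → ℕ             -- the variable `degree`
    pending : List (Msg n)

open State public

update : ∀ {n} {A : Set} → (Fin n → A) → Fin n → A → Fin n → A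
update f v x u = if does (u ≟ v) then x else f u

offs : ∀ {n} → Graph n → Fin n → List (Msg n)
offs G v = map (λ u → (v , u)) (neighbours G v)

-- onInitial, executed by every node at the start
initial : ∀ {n} → Graph n → (Fin n → ℕ) → State n
initial {n} G k = record
  { active  = λ v → not (deg G v <ᵇ k v)
  ; counter = λ v → deg G v
  ; pending = concatMap (λ v → if deg G v <ᵇ k v then offs G v else []) (allFin n)
  }

-- onMessage at the receiver v; `rest` is the remaining in-flight messages
receive : ∀ {n} → Graph n → (Fin n → ℕ) → Fin n → List (Msg n) → State n → State n
receive G k v rest σ =
  if active σ v
  then (if (counter σ v ∸ 1) <ᵇ k v
        then record { active = update (active σ) v false
                    ; counter = update (counter σ) v (counter σ v ∸ 1)
                    ; pending = rest ++ offs G v }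
        else record { active = active σ
                    ; counter = update (counter σ) v (counter σ v ∸ 1)
                    ; pending = rest })
  else record { active = active σ ; counter = counter σ ; pending = rest }

-- one step: some in-flight message (any one, in any order) is delivered and processed
data Step {n : ℕ} (G : Graph n) (k : Fin n → ℕ) : State n → State n → Set where
  deliver : ∀ (σ : State n) (xs ys : List (Msg n)) (s r : Fin n) →
            pending σ ≡ xs ++ (s , r) ∷ ys →
            Step G k σ (receive G k r (xs ++ ys) σ)

Reachable : ∀ {n} → Graph n → (Fin n → ℕ) → State n → Set
Reachable G k σ = Star (Step G k) (initial G k) σ

-- Invariant: the counter of an active node equals the number of its active
-- neighbours plus the number of off messages still in flight to it, and is at
-- least its threshold. Once nothing is in flight the counters are therefore the
-- degrees in the subgraph induced by the active nodes, which thus meets the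
-- thresholds. Conversely, no node of a subgraph H meeting the thresholds is ever
-- the first of H to be switched off: while all of H is active, such a node has at
-- least its threshold many active neighbours, and by the invariant its counter
-- stays at least that large after the decrement. The partition only supplies the thresholds.
module Submission where

open import Defs hiding (sym)

open import Data.Bool using (Bool; true; false; not; if_then_else_; T)
open import Data.Bool.Properties using (not-injective)
open import Data.Empty using (⊥-elim)
open import Data.Fin using (Fin; zero; suc; _≟_)
open import Data.List using (List; []; _∷_; _++_; map; filterᵇ; concatMap; allFin; length)
open import Data.List.Properties using (map-tabulate)
open import Data.Nat using (ℕ; suc; _+_; _∸_; _<ᵇ_; _≤_; _<_; z≤n; s≤s)
open import Data.Nat.Properties
  using (+-identityʳ; +-suc; +-assoc; +-comm; +-mono-≤; m≤m+n; ≤-trans; ≤⇒≯; ≮⇒≥; <ᵇ⇒<; <⇒<ᵇ; module ≤-Reasoning; +-commutativeSemigroup)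
open import Algebra.Properties.CommutativeSemigroup +-commutativeSemigroup using (interchange; x∙yz≈y∙xz)
open import Data.Product using (_×_; _,_; proj₁; proj₂)
open import Data.Unit using (tt)
open import Function using (_∘_; id)
open import Relation.Binary.Construct.Closure.ReflexiveTransitive using (fold)
open import Relation.Binary.PropositionalEquality
  using (_≡_; _≢_; refl; sym; trans; cong; cong₂; subst; subst₂)
open import Relation.Nullary using (does; yes; no)
open import Relation.Nullary.Decidable using (dec-true; dec-false)

open ≤-Reasoning

private variable
  A B : Set

⟦_⟧ : Bool → ℕ
⟦ true ⟧  = 1
⟦ false ⟧ = 0

and-trueʳ : ∀ b → (b and true) ≡ b
and-trueʳ true  = refl
and-trueʳ false = refl

and-falseʳ : ∀ b → (b and false) ≡ false
and-falseʳ true  = refl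
and-falseʳ false = refl

<ᵇ-true⇒< : ∀ {m n} → (m <ᵇ n) ≡ true → m < n
<ᵇ-true⇒< {m} {n} m<ᵇn = <ᵇ⇒< m n (subst T (sym m<ᵇn) tt)

<ᵇ-false⇒≥ : ∀ {m n} → (m <ᵇ n) ≡ false → n ≤ m
<ᵇ-false⇒≥ m≮ᵇn = ≮⇒≥ (λ m<n → subst T m≮ᵇn (<⇒<ᵇ m<n))

_==_ : ∀ {n} → Fin n → Fin n → Bool
u == v = does (u ≟ v)

count : (A → Bool) → List A → ℕ
count p []       = 0
count p (x ∷ xs) = ⟦ p x ⟧ + count p xs

length-filterᵇ : ∀ (p : A → Bool) xs → length (filterᵇ p xs) ≡ count p xs
length-filterᵇ p [] = refl
length-filterᵇ p (x ∷ xs) with p x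
... | true  = cong suc (length-filterᵇ p xs)
... | false = length-filterᵇ p xs

count-++ : ∀ (p : A → Bool) xs ys → count p (xs ++ ys) ≡ count p xs + count p ys
count-++ p []       ys = refl
count-++ p (x ∷ xs) ys = trans (cong (⟦ p x ⟧ +_) (count-++ p xs ys)) (sym (+-assoc ⟦ p x ⟧ _ _))

count-middle : ∀ (p : A → Bool) xs x ys → count p (xs ++ x ∷ ys) ≡ ⟦ p x ⟧ + count p (xs ++ ys)
count-middle p []       x ys = refl
count-middle p (y ∷ xs) x ys =
  trans (cong (⟦ p y ⟧ +_) (count-middle p xs x ys)) (x∙yz≈y∙xz ⟦ p y ⟧ ⟦ p x ⟧ _)

count-filterᵇ : ∀ (p q : A → Bool) xs → count p (filterᵇ q xs) ≡ count (λ x → q x and p x) xs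
count-filterᵇ p q [] = refl
count-filterᵇ p q (x ∷ xs) with q x
... | true  = cong (⟦ p x ⟧ +_) (count-filterᵇ p q xs)
... | false = count-filterᵇ p q xs

count-cong : ∀ {p q : A → Bool} → (∀ x → p x ≡ q x) → ∀ xs → count p xs ≡ count q xs
count-cong p≗q []       = refl
count-cong p≗q (x ∷ xs) = cong₂ _+_ (cong ⟦_⟧ (p≗q x)) (count-cong p≗q xs)

count-false : ∀ {p : A → Bool} → (∀ x → p x ≡ false) → ∀ xs → count p xs ≡ 0
count-false p≡false []       = refl
count-false p≡false (x ∷ xs) rewrite p≡false x = count-false p≡false xs

count-split : ∀ {p q r : A → Bool} → (∀ x → ⟦ p x ⟧ ≡ ⟦ q x ⟧ + ⟦ r x ⟧) →
  ∀ xs → count p xs ≡ count q xs + count r xs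
count-split split []       = refl
count-split {q = q} {r} split (x ∷ xs) =
  trans (cong₂ _+_ (split x) (count-split split xs)) (interchange ⟦ q x ⟧ ⟦ r x ⟧ _ _)

count-mono : ∀ {p q : A → Bool} → (∀ x → p x ≡ true → q x ≡ true) → ∀ xs → count p xs ≤ count q xs
count-mono p⊆q []       = z≤n
count-mono {p = p} {q} p⊆q (x ∷ xs) = +-mono-≤ (⟦⟧-mono (p x) (q x) (p⊆q x)) (count-mono p⊆q xs)
  where
  ⟦⟧-mono : ∀ a b → (a ≡ true → b ≡ true) → ⟦ a ⟧ ≤ ⟦ b ⟧
  ⟦⟧-mono false b a⇒b = z≤n
  ⟦⟧-mono true  b a⇒b rewrite a⇒b refl = s≤s z≤n

count-concatMap : ∀ {p : B → Bool} {f : A → List B} {q : A → Bool} →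
  (∀ x → count p (f x) ≡ ⟦ q x ⟧) → ∀ xs → count p (concatMap f xs) ≡ count q xs
count-concatMap f≈q []       = refl
count-concatMap {p = p} {f} f≈q (x ∷ xs) =
  trans (count-++ p (f x) _) (cong₂ _+_ (f≈q x) (count-concatMap f≈q xs))

count-map : ∀ (p : B → Bool) (f : A → B) xs → count p (map f xs) ≡ count (p ∘ f) xs
count-map p f []       = refl
count-map p f (x ∷ xs) = cong (⟦ p (f x) ⟧ +_) (count-map p f xs)

count-allFin-suc : ∀ {n} (p : Fin (suc n) → Bool) →
  count p (allFin (suc n)) ≡ ⟦ p zero ⟧ + count (p ∘ suc) (allFin n)
count-allFin-suc {n} p =
  cong (⟦ p zero ⟧ +_) (trans (cong (count p) (sym (map-tabulate id suc))) (count-map p suc (allFin n)))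

count-allFin-at : ∀ {n} (f : Fin n → Bool) (x : Fin n) → count (λ u → f u and (u == x)) (allFin n) ≡ ⟦ f x ⟧
count-allFin-at {suc n} f zero
  rewrite count-allFin-suc (λ u → f u and (u == zero))
        | and-trueʳ (f zero)
        | count-false (λ u → and-falseʳ (f (suc u))) (allFin n) = +-identityʳ ⟦ f zero ⟧
count-allFin-at {suc n} f (suc x)
  rewrite count-allFin-suc (λ u → f u and (u == suc x))
        | and-falseʳ (f zero) = count-allFin-at (f ∘ suc) x

module Peeling {n : ℕ} (G : Graph n) (k : Fin n → ℕ) where

  activeNbrs : (Fin n → Bool) → Fin n → ℕ
  activeNbrs a v = count (λ u → a u and adj G v u) (allFin n)

  inbox : List (Msg n) → Fin n → ℕ
  inbox ms v = count (λ m → proj₂ m == v) ms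

  Consistent : State n → Set
  Consistent σ = ∀ v → active σ v ≡ true →
    (counter σ v ≡ activeNbrs (active σ) v + inbox (pending σ) v) × (k v ≤ counter σ v)

  record PendingSplit (σ : State n) (r : Fin n) (rest : List (Msg n)) : Set where
    field inbox-split : ∀ v → inbox (pending σ) v ≡ ⟦ r == v ⟧ + inbox rest v
  open PendingSplit

  pendingSplit : ∀ {σ xs s r ys} → pending σ ≡ xs ++ (s , r) ∷ ys → PendingSplit σ r (xs ++ ys)
  pendingSplit {xs = xs} {s} {r} {ys} eq .inbox-split v =
    trans (cong (λ ms → inbox ms v) eq) (count-middle (λ m → proj₂ m == v) xs (s , r) ys)

  inbox-elsewhere : ∀ {σ r rest v} → PendingSplit σ r rest → r ≢ v → inbox (pending σ) v ≡ inbox rest v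
  inbox-elsewhere {r = r} {rest} {v} split r≢v =
    trans (inbox-split split v) (cong (λ b → ⟦ b ⟧ + inbox rest v) (dec-false (r ≟ v) r≢v))

  inbox-offs : ∀ u v → inbox (offs G u) v ≡ ⟦ adj G u v ⟧
  inbox-offs u v = begin-equality
    count (λ m → proj₂ m == v) (map (u ,_) (neighbours G u))  ≡⟨ count-map _ (u ,_) (neighbours G u) ⟩
    count (_== v) (filterᵇ (adj G u) (allFin n))              ≡⟨ count-filterᵇ (_== v) (adj G u) (allFin n) ⟩
    count (λ w → adj G u w and (w == v)) (allFin n)           ≡⟨ count-allFin-at (adj G u) v ⟩
    ⟦ adj G u v ⟧                                             ∎

  activeNbrs-switchOff : ∀ {a r} → a r ≡ true → ∀ v →
    activeNbrs a v ≡ activeNbrs (update a r false) v + ⟦ adj G v r ⟧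
  activeNbrs-switchOff {a} {r} ar v =
    trans (count-split pointwise (allFin n)) (cong (activeNbrs (update a r false) v +_) (count-allFin-at (adj G v) r))
    where
    pointwise : ∀ u → ⟦ a u and adj G v u ⟧ ≡ ⟦ update a r false u and adj G v u ⟧ + ⟦ adj G v u and (u == r) ⟧
    pointwise u with u ≟ r
    ... | yes refl rewrite ar | and-trueʳ (adj G v u) = refl
    ... | no _     rewrite and-falseʳ (adj G v u) = sym (+-identityʳ _)

  counter-on-receipt : ∀ {σ r rest} → Consistent σ → PendingSplit σ r rest → active σ r ≡ true →
    counter σ r ∸ 1 ≡ activeNbrs (active σ) r + inbox rest r
  counter-on-receipt {σ} {r} {rest} consistent split ar = begin-equality
    counter σ r ∸ 1                                              ≡⟨ cong (_∸ 1) (proj₁ (consistent r ar)) ⟩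
    (activeNbrs (active σ) r + inbox (pending σ) r) ∸ 1          ≡⟨ cong (λ i → (activeNbrs (active σ) r + i) ∸ 1) (inbox-split split r) ⟩
    (activeNbrs (active σ) r + (⟦ r == r ⟧ + inbox rest r)) ∸ 1  ≡⟨ cong (λ b → (activeNbrs (active σ) r + (⟦ b ⟧ + inbox rest r)) ∸ 1) (dec-true (r ≟ r) refl) ⟩
    (activeNbrs (active σ) r + suc (inbox rest r)) ∸ 1           ≡⟨ cong (_∸ 1) (+-suc _ (inbox rest r)) ⟩
    activeNbrs (active σ) r + inbox rest r                       ∎

  initial-counter : ∀ v → deg G v ≡ activeNbrs (active (initial G k)) v + inbox (pending (initial G k)) v
  initial-counter v = begin-equality
    deg G v                                       ≡⟨ length-filterᵇ (adj G v) (allFin n) ⟩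
    count (adj G v) (allFin n)                    ≡⟨ count-split pointwise (allFin n) ⟩
    activeNbrs (active (initial G k)) v + count offAdj (allFin n)
      ≡⟨ cong (activeNbrs (active (initial G k)) v +_) (sym (count-concatMap inbox-sent (allFin n))) ⟩
    activeNbrs (active (initial G k)) v + inbox (pending (initial G k)) v ∎
    where
    isOff : Fin n → Bool
    isOff u = deg G u <ᵇ k u
    offAdj : Fin n → Bool
    offAdj u = isOff u and adj G u v
    pointwise : ∀ u → ⟦ adj G v u ⟧ ≡ ⟦ not (isOff u) and adj G v u ⟧ + ⟦ offAdj u ⟧
    pointwise u rewrite Graph.sym G u v with isOff u
    ... | true  = refl
    ... | false = sym (+-identityʳ _)
    inbox-sent : ∀ u → inbox (if isOff u then offs G u else []) v ≡ ⟦ offAdj u ⟧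
    inbox-sent u with isOff u
    ... | true  = inbox-offs u v
    ... | false = refl

  consistent-initial : Consistent (initial G k)
  consistent-initial v notOff = initial-counter v , <ᵇ-false⇒≥ (not-injective notOff)

  consistent-ignore : ∀ {σ r rest} → Consistent σ → PendingSplit σ r rest → active σ r ≡ false →
    Consistent (record { active = active σ ; counter = counter σ ; pending = rest })
  consistent-ignore {σ} {r} consistent split r-off v av =
    trans (proj₁ (consistent v av)) (cong (activeNbrs (active σ) v +_) (inbox-elsewhere split r≢v)) ,
    proj₂ (consistent v av)
    where
    r≢v : r ≢ v
    r≢v refl with trans (sym r-off) av
    ... | ()

  consistent-decrement : ∀ {σ r rest} → Consistent σ → PendingSplit σ r rest → active σ r ≡ true →
    k r ≤ counter σ r ∸ 1 →
    Consistent (record { active = active σ ; counter = update (counter σ) r (counter σ r ∸ 1) ; pending = rest })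
  consistent-decrement {σ} {r} consistent split ar kr≤ v av with v ≟ r
  ... | yes refl = counter-on-receipt consistent split ar , kr≤
  ... | no v≢r   =
    trans (proj₁ (consistent v av)) (cong (activeNbrs (active σ) v +_) (inbox-elsewhere split (v≢r ∘ sym))) ,
    proj₂ (consistent v av)

  consistent-switchOff : ∀ {σ r rest} → Consistent σ → PendingSplit σ r rest → active σ r ≡ true →
    Consistent (record { active = update (active σ) r false
                       ; counter = update (counter σ) r (counter σ r ∸ 1)
                       ; pending = rest ++ offs G r })
  consistent-switchOff {σ} {r} {rest} consistent split ar v av with v ≟ r
  consistent-switchOff consistent split ar v () | yes refl
  ... | no v≢r = counter≡ , proj₂ (consistent v av)
    where
    a′ : Fin n → Bool
    a′ = update (active σ) r false
    counter≡ : counter σ v ≡ activeNbrs a′ v + inbox (rest ++ offs G r) v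
    counter≡ = begin-equality
      counter σ v                                             ≡⟨ proj₁ (consistent v av) ⟩
      activeNbrs (active σ) v + inbox (pending σ) v
        ≡⟨ cong₂ _+_ (activeNbrs-switchOff ar v) (inbox-elsewhere split (v≢r ∘ sym)) ⟩
      (activeNbrs a′ v + ⟦ adj G v r ⟧) + inbox rest v        ≡⟨ +-assoc (activeNbrs a′ v) _ _ ⟩
      activeNbrs a′ v + (⟦ adj G v r ⟧ + inbox rest v)        ≡⟨ cong (activeNbrs a′ v +_) (+-comm _ (inbox rest v)) ⟩
      activeNbrs a′ v + (inbox rest v + ⟦ adj G v r ⟧)
        ≡⟨ cong (λ b → activeNbrs a′ v + (inbox rest v + ⟦ b ⟧)) (Graph.sym G v r) ⟩
      activeNbrs a′ v + (inbox rest v + ⟦ adj G r v ⟧)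
        ≡⟨ cong (activeNbrs a′ v +_) (sym (trans (count-++ _ rest (offs G r)) (cong (inbox rest v +_) (inbox-offs r v)))) ⟩
      activeNbrs a′ v + inbox (rest ++ offs G r) v            ∎

  consistent-step : ∀ {σ σ′} → Step G k σ σ′ → Consistent σ → Consistent σ′
  consistent-step (deliver σ xs ys s r eq) consistent with active σ r in ar
  ... | false = consistent-ignore consistent (pendingSplit eq) ar
  ... | true with counter σ r ∸ 1 <ᵇ k r in below
  ...   | true  = consistent-switchOff consistent (pendingSplit eq) ar
  ...   | false = consistent-decrement consistent (pendingSplit eq) ar (<ᵇ-false⇒≥ below)

  reachable-invariant : ∀ {P : State n → Set} → P (initial G k) → (∀ {σ σ′} → Step G k σ σ′ → P σ → P σ′) →
    ∀ {σ} → Reachable G k σ → P σ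
  reachable-invariant {P} P₀ preserved reach =
    fold (λ σ σ′ → P σ → P σ′) (λ step rest → rest ∘ preserved step) id reach P₀

  Retains : Subgraph G → (Fin n → Bool) → Set
  Retains H a = ∀ v → vert H v ≡ true → a v ≡ true

  degIn≤activeNbrs : ∀ {H a} → Retains H a → ∀ v → degIn H v ≤ activeNbrs a v
  degIn≤activeNbrs {H} {a} retains v =
    subst (_≤ activeNbrs a v) (sym (length-filterᵇ (edge H v) (allFin n))) (count-mono edge⇒active (allFin n))
    where
    edge⇒active : ∀ u → edge H v u ≡ true → (a u and adj G v u) ≡ true
    edge⇒active u e rewrite retains u (edge⊆V H u v (trans (edge-sym H u v) e)) = edge⊆G H v u e

  degIn≤deg : ∀ (H : Subgraph G) v → degIn H v ≤ deg G v
  degIn≤deg H v = subst₂ _≤_ (sym (length-filterᵇ (edge H v) (allFin n))) (sym (length-filterᵇ (adj G v) (allFin n)))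
    (count-mono (edge⊆G H v) (allFin n))

  retains-switchOff : ∀ {H a r} → vert H r ≢ true → Retains H a → Retains H (update a r false)
  retains-switchOff {r = r} r∉H retains v v∈H with v ≟ r
  ... | yes refl = ⊥-elim (r∉H v∈H)
  ... | no _     = retains v v∈H

  module _ (H : Subgraph G) (minDeg : MinDeg k H) where

    retains-initial : Retains H (active (initial G k))
    retains-initial v v∈H with deg G v <ᵇ k v in low
    ... | false = refl
    ... | true  = ⊥-elim (≤⇒≯ (≤-trans (minDeg v v∈H) (degIn≤deg H v)) (<ᵇ-true⇒< low))

    retains-step : ∀ {σ σ′} → Step G k σ σ′ → Consistent σ → Retains H (active σ) → Retains H (active σ′)
    retains-step (deliver σ xs ys s r eq) consistent retains with active σ r in ar
    ... | false = retains
    ... | true with counter σ r ∸ 1 <ᵇ k r in below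
    ...   | false = retains
    ...   | true  = retains-switchOff {H} r∉H retains
      where
      r∉H : vert H r ≢ true
      r∉H r∈H = ≤⇒≯ (begin
        k r                           ≤⟨ minDeg r r∈H ⟩
        degIn H r                     ≤⟨ degIn≤activeNbrs {H} retains r ⟩
        activeNbrs (active σ) r       ≤⟨ m≤m+n _ _ ⟩
        activeNbrs (active σ) r + inbox (xs ++ ys) r ≡⟨ sym (counter-on-receipt consistent (pendingSplit eq) ar) ⟩
        counter σ r ∸ 1               ∎) (<ᵇ-true⇒< below)

    retains-reachable : ∀ {σ} → Reachable G k σ → Retains H (active σ)
    retains-reachable reach = proj₂ (reachable-invariant {λ σ → Consistent σ × Retains H (active σ)}
      (consistent-initial , retains-initial)
      (λ step (c , r) → consistent-step step c , retains-step step c r) reach)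

  degIn-induced : ∀ {a v} → a v ≡ true → degIn (induced G a) v ≡ activeNbrs a v
  degIn-induced {a} {v} av =
    trans (length-filterᵇ _ (allFin n)) (count-cong (λ u → cong (λ b → b and (a u and adj G v u)) av) (allFin n))

  retains⇒⊆induced : ∀ {H a} → Retains H a → H ⊆G induced G a
  retains⇒⊆induced {H} {a} retains = retains , edges
    where
    edges : ∀ u v → edge H u v ≡ true → (a u and (a v and adj G u v)) ≡ true
    edges u v e rewrite retains u (edge⊆V H u v e) | retains v (edge⊆V H v u (trans (edge-sym H v u) e)) = edge⊆G H u v e

  quiescent-minDeg : ∀ {σ} → Reachable G k σ → pending σ ≡ [] → MinDeg k (induced G (active σ))
  quiescent-minDeg {σ} reach quiet v av = begin
    k v                                                   ≤⟨ proj₂ (consistent v av) ⟩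
    counter σ v                                           ≡⟨ proj₁ (consistent v av) ⟩
    activeNbrs (active σ) v + inbox (pending σ) v         ≡⟨ cong (λ ms → activeNbrs (active σ) v + inbox ms v) quiet ⟩
    activeNbrs (active σ) v + 0                           ≡⟨ +-identityʳ _ ⟩
    activeNbrs (active σ) v                               ≡⟨ sym (degIn-induced av) ⟩
    degIn (induced G (active σ)) v                        ∎
    where
    consistent : Consistent σ
    consistent = reachable-invariant consistent-initial consistent-step reach

corollary4 : ∀ (n p : ℕ) (G : Graph n) (part : Fin n → Fin p) → IsPartite G part →
    (ks : Fin p → ℕ) (σ : State n) →
    Reachable G (λ v → ks (part v)) σ → pending σ ≡ [] →
    IsLargest (λ v → ks (part v)) (induced G (active σ))
corollary4 n p G part _ ks σ reach quiet =
  quiescent-minDeg reach quiet , λ H minDeg → retains⇒⊆induced {H} (retains-reachable H minDeg reach)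
  where open Peeling G (λ v → ks (part v))
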